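{- Let $G$ and $H$ be $m$-edge coloured graphs (with the same underlying graph) and let $\Gamma\subseteq S_m$ be a group acting transitively on $\{1,\dots,m\}$. Then $G$ and $H$ are $\Gamma$-switch equivalent if and only if $G^{\Gamma}$ and $H^{\Gamma}$ are $\Gamma^{ab}$-switch equivalent.
   Context: An $m$-edge coloured graph is a finite simple graph with each edge coloured from $\{1,\dots,m\}$. Switching at a vertex $v$ w.r.t. $\pi$ replaces the colour $c$ of each edge at $v$ by $\pi(c)$; two coloured graphs are $\Gamma$-switch equivalent if one is obtained from the other by a finite sequence of switches with elements of $\Gamma$. Let $[\Gamma,\Gamma]$ be the commutator subgroup of $\Gamma$, and for a colour $i$ let $\Delta(i)=\{\tau(i):\tau\in[\Gamma,\Gamma]\}$ be its orbit; the distinct orbits $D=\{\Delta(1),\dots,\Delta(m)\}$ form a block system for $\Gamma$, and we regard these $m'$ orbits as new colours. The Abelianization $G^\Gamma$ of $G$ is obtained by recolouring every edge of colour $i$ with colour $\Delta(i)$. The Abelianization $\Gamma^{ab}$ of $\Gamma$ is the group of permutations of $D$ induced by $\Gamma$, i.e. each $\pi\in\Gamma$ (equivalently, its coset $\pi[\Gamma,\Gamma]$) induces $\pi':\Delta(i)\mapsto\Delta(\pi(i))$, and elements of $\Gamma/[\Gamma,\Gamma]$ acting identically on $D$ are identified; $\Gamma^{ab}$ is an Abelian group acting transitively on $D$. Switching $G^\Gamma$ at $u$ w.r.t. $\pi'$ changes the colour $\Delta(i)$ of each edge at $u$ to $\pi'(\Delta(i))=\Delta(\pi(i))$; $\Gamma^{ab}$-switch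 equivalence is defined accordingly. -}

module Defs where

open import Data.Nat using (ℕ)
open import Data.Fin using (Fin; _≟_)
open import Data.Fin.Permutation
  using (Permutation′; _⟨$⟩ʳ_; id; flip; _∘ₚ_) renaming (_≈_ to _≈ₚ_)
open import Data.Maybe using (Maybe; just; nothing)
import Data.Maybe as Maybe
open import Data.Bool using (if_then_else_; _∨_)
open import Data.List using (List; []; _∷_; foldr)
open import Data.List.Relation.Unary.All using (All)
open import Data.Product using (Σ; ∃; _×_; _,_; proj₁; proj₂)
open import Relation.Binary.PropositionalEquality using (_≡_)
open import Relation.Nullary using (⌊_⌋)
open import Data.Unit using (⊤)
open import Data.Empty using (⊥)

record IsPermGroup {m : ℕ} (Γ : Permutation′ m → Set) : Set where
  field
    respects : ∀ {π ρ} → π ≈ₚ ρ → Γ π → Γ ρ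
    has-id   : Γ id
    closed-∘ : ∀ {π ρ} → Γ π → Γ ρ → Γ (π ∘ₚ ρ)
    closed-⁻¹ : ∀ {π} → Γ π → Γ (flip π)

Transitive : {m : ℕ} → (Permutation′ m → Set) → Set
Transitive {m} Γ = ∀ (i j : Fin m) → Σ (Permutation′ m) λ π → Γ π × π ⟨$⟩ʳ i ≡ j

-- Commutator subgroup [Γ,Γ]: the subgroup generated by the commutators
-- [a,b] = a b a⁻¹ b⁻¹ (a,b ∈ Γ).  Since [a,b]⁻¹ = [b,a], its elements are
-- exactly the (possibly empty) products of commutators.

commutator : {m : ℕ} → Permutation′ m → Permutation′ m → Permutation′ m
commutator a b = flip b ∘ₚ flip a ∘ₚ b ∘ₚ a

prodComm : {m : ℕ} → List (Permutation′ m × Permutation′ m) → Permutation′ m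
prodComm = foldr (λ ab τ → commutator (proj₁ ab) (proj₂ ab) ∘ₚ τ) id

InCommutatorSubgroup : {m : ℕ} → (Permutation′ m → Set) → Permutation′ m → Set
InCommutatorSubgroup {m} Γ τ =
  Σ (List (Permutation′ m × Permutation′ m)) λ cs →
    All (λ ab → Γ (proj₁ ab) × Γ (proj₂ ab)) cs × (prodComm cs ≈ₚ τ)

-- j ∈ Δ(i) = { τ(i) : τ ∈ [Γ,Γ] };  equivalently Δ(i) = Δ(j).
-- Colours of the Abelianization are the orbits Δ(i); we represent the
-- orbit Δ(i) by any representative i, identified up to _∼Δ_.
_∼Δ[_]_ : {m : ℕ} → Fin m → (Permutation′ m → Set) → Fin m → Set
_∼Δ[_]_ {m} i Γ j = Σ (Permutation′ m) λ τ → InCommutatorSubgroup Γ τ × τ ⟨$⟩ʳ i ≡ j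

-- Edge coloured graphs on vertex set Fin n.
-- col u v = nothing : no edge;  col u v = just c : edge uv of colour c.

Colouring : ℕ → Set → Set
Colouring n C = Fin n → Fin n → Maybe C

record ColouredGraph (n m : ℕ) : Set where
  field
    col       : Colouring n (Fin m)
    symmetric : ∀ u v → col u v ≡ col v u
    loopless  : ∀ v → col v v ≡ nothing
open ColouredGraph public

SameUnderlying : {n m : ℕ} → ColouredGraph n m → ColouredGraph n m → Set
SameUnderlying G H =
  ∀ u v → (col G u v ≡ nothing → col H u v ≡ nothing)
        × (col H u v ≡ nothing → col G u v ≡ nothing)

switch : {n : ℕ} {C : Set} → Fin n → (C → C) → Colouring n C → Colouring n C
switch v f c x y =
  if ⌊ x ≟ v ⌋ ∨ ⌊ y ≟ v ⌋ then Maybe.map f (c x y) else c x y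

-- apply a finite sequence of switches (head applied last)
switchAll : {n m : ℕ} → List (Fin n × Permutation′ m) →
            Colouring n (Fin m) → Colouring n (Fin m)
switchAll ss c = foldr (λ vπ d → switch (proj₁ vπ) (proj₂ vπ ⟨$⟩ʳ_) d) c ss

SwitchEquiv : {n m : ℕ} → (Permutation′ m → Set) →
              ColouredGraph n m → ColouredGraph n m → Set
SwitchEquiv {n} {m} Γ G H =
  Σ (List (Fin n × Permutation′ m)) λ ss →
    All (λ vπ → Γ (proj₂ vπ)) ss × (∀ x y → switchAll ss (col G) x y ≡ col H x y)

-- G^Γ: the graph G with colour i replaced by the orbit Δ(i).  A colouring
-- by orbits is represented by representatives, with equality of colours
-- given by _∼Δ_ (orbit equality).
Abelianization : {n m : ℕ} → (Permutation′ m → Set) → ColouredGraph n m →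
                 Colouring n (Fin m)
Abelianization Γ G = col G

MaybeΔ : {m : ℕ} → (Permutation′ m → Set) → Maybe (Fin m) → Maybe (Fin m) → Set
MaybeΔ Γ nothing  nothing  = ⊤
MaybeΔ Γ nothing  (just _) = ⊥
MaybeΔ Γ (just _) nothing  = ⊥
MaybeΔ Γ (just i) (just j) = i ∼Δ[ Γ ] j

_≈Δ[_]_ : {n m : ℕ} → Colouring n (Fin m) → (Permutation′ m → Set) →
          Colouring n (Fin m) → Set
c ≈Δ[ Γ ] d = ∀ x y → MaybeΔ Γ (c x y) (d x y)

-- Every element π' of
-- Γ^ab is induced by some π ∈ Γ via π'(Δ(i)) = Δ(π(i)) (well defined as
-- [Γ,Γ] is normal), and elements acting identically on D are identified,
-- so a Γ^ab-switch at u is given by some π ∈ Γ acting on representatives;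
-- the final colouring is compared up to orbit equality.
AbSwitchEquiv : {n m : ℕ} → (Permutation′ m → Set) →
                Colouring n (Fin m) → Colouring n (Fin m) → Set
AbSwitchEquiv {n} {m} Γ c d =
  Σ (List (Fin n × Permutation′ m)) λ ss →
    All (λ vπ → Γ (proj₂ vπ)) ss × (switchAll ss c ≈Δ[ Γ ] d)

{-# OPTIONS --safe #-}
-- Switching at u by b⁻¹, at v by a⁻¹, at u by b and at v by a leaves every
-- edge untouched except uv, whose colour is moved by the commutator [a,b].
-- Hence every element of [Γ,Γ] can be applied to a single edge.  Perform the
-- Γ^ab-switches with the same elements of Γ; afterwards every edge has its
-- colour in the correct [Γ,Γ]-orbit and can be corrected edge by edge.
module Submission where

open import Defs
open import Data.Nat using (ℕ)
open import Data.Bool using (Bool; true; false; T; if_then_else_; _∨_; _∧_)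
open import Data.Bool.Properties using (∨-comm; T-∧; T-∨)
open import Data.Empty using (⊥-elim)
open import Data.Fin using (Fin; _≟_)
open import Data.Fin.Permutation using (Permutation′; _⟨$⟩ʳ_; inverseʳ; flip; id)
open import Data.List using (List; []; _∷_; _++_; allFin; cartesianProduct)
open import Data.List.Membership.Propositional using (_∈_)
open import Data.List.Membership.Propositional.Properties
  using (∈-cartesianProduct⁺; ∈-allFin)
open import Data.List.Relation.Unary.All using (All; []; _∷_)
open import Data.List.Relation.Unary.All.Properties using (++⁺)
open import Data.List.Relation.Unary.Any using (here; there)
open import Data.Maybe using (Maybe; just; nothing; map)
open import Data.Maybe.Properties using (map-∘; map-cong)
open import Data.Product using (∃; Σ; _×_; _,_; proj₁; proj₂)
open import Data.Sum using (_⊎_; inj₁; inj₂)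
open import Data.Unit using (tt)
open import Function using (_∘_; Equivalence)
open import Relation.Binary.PropositionalEquality
open import Relation.Nullary using (¬_; yes; no; ⌊_⌋)
open import Relation.Nullary.Decidable using (T?; toWitness; fromWitness)

open Equivalence using (to; from)

mapIf : {C : Set} → Bool → (C → C) → Maybe C → Maybe C
mapIf b f z = if b then map f z else z

module _ {C : Set} where

  mapIf-true : ∀ {b} (f : C → C) z → T b → mapIf b f z ≡ map f z
  mapIf-true {true} f z _ = refl

  mapIf-false : ∀ {b} (f : C → C) z → ¬ T b → mapIf b f z ≡ z
  mapIf-false {true}  f z ¬t = ⊥-elim (¬t tt)
  mapIf-false {false} f z _  = refl

  mapIf-∘ : ∀ b (f g : C → C) z → mapIf b g (mapIf b f z) ≡ mapIf b (g ∘ f) z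
  mapIf-∘ true  f g z = sym (map-∘ z)
  mapIf-∘ false f g z = refl

  mapIf-id : ∀ b (z : Maybe C) → mapIf b (λ c → c) z ≡ z
  mapIf-id true  (just c) = refl
  mapIf-id true  nothing  = refl
  mapIf-id false z        = refl

  mapIf-cong : ∀ b {f g : C → C} → (∀ c → f c ≡ g c) → ∀ z → mapIf b f z ≡ mapIf b g z
  mapIf-cong true  f≗g z = map-cong f≗g z
  mapIf-cong false f≗g z = refl

mapIf-commutator : ∀ {m} (a b : Permutation′ m) bu bv z →
  mapIf bv (a ⟨$⟩ʳ_) (mapIf bu (b ⟨$⟩ʳ_) (mapIf bv (flip a ⟨$⟩ʳ_) (mapIf bu (flip b ⟨$⟩ʳ_) z)))
  ≡ mapIf (bu ∧ bv) (commutator a b ⟨$⟩ʳ_) z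
mapIf-commutator a b true  true  (just c) = refl
mapIf-commutator a b true  false (just c) = cong just (inverseʳ b)
mapIf-commutator a b false true  (just c) = cong just (inverseʳ a)
mapIf-commutator a b false false (just c) = refl
mapIf-commutator a b true  true  nothing  = refl
mapIf-commutator a b true  false nothing  = refl
mapIf-commutator a b false true  nothing  = refl
mapIf-commutator a b false false nothing  = refl

module _ {n : ℕ} where

  -- switch v f c p q unfolds to mapIf (incident v p q) f (c p q).
  incident : Fin n → Fin n → Fin n → Bool
  incident v p q = ⌊ p ≟ v ⌋ ∨ ⌊ q ≟ v ⌋

  joins : Fin n → Fin n → Fin n → Fin n → Bool
  joins u v p q = incident u p q ∧ incident v p q

  incident-left : ∀ v q → T (incident v v q)
  incident-left v q = from T-∨ (inj₁ (fromWitness {a? = v ≟ v} refl))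

  incident-right : ∀ v p → T (incident v p v)
  incident-right v p = from T-∨ (inj₂ (fromWitness {a? = v ≟ v} refl))

  incident⇒endpoint : ∀ {v p q} → T (incident v p q) → p ≡ v ⊎ q ≡ v
  incident⇒endpoint {v} {p} {q} t with to T-∨ t
  ... | inj₁ t-p = inj₁ (toWitness {a? = p ≟ v} t-p)
  ... | inj₂ t-q = inj₂ (toWitness {a? = q ≟ v} t-q)

  joins-self : ∀ u v → T (joins u v u v)
  joins-self u v = from T-∧ (incident-left u v , incident-right v u)

  joins⇒endpoints : ∀ {u v p q} → u ≢ v → T (joins u v p q) →
                    (p ≡ u × q ≡ v) ⊎ (p ≡ v × q ≡ u)
  joins⇒endpoints u≢v t
    with incident⇒endpoint (proj₁ (to T-∧ t)) | incident⇒endpoint (proj₂ (to T-∧ t))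
  ... | inj₁ p≡u | inj₁ p≡v = ⊥-elim (u≢v (trans (sym p≡u) p≡v))
  ... | inj₁ p≡u | inj₂ q≡v = inj₁ (p≡u , q≡v)
  ... | inj₂ q≡u | inj₁ p≡v = inj₂ (p≡v , q≡u)
  ... | inj₂ q≡u | inj₂ q≡v = ⊥-elim (u≢v (trans (sym q≡u) q≡v))

  module _ {C : Set} where

    _≐_ : Colouring n C → Colouring n C → Set
    c ≐ d = ∀ p q → c p q ≡ d p q

    Symmetric : Colouring n C → Set
    Symmetric c = ∀ p q → c p q ≡ c q p

    switch-cong : ∀ v (f : C → C) {c d} → c ≐ d → switch v f c ≐ switch v f d
    switch-cong v f c≐d p q = cong (mapIf (incident v p q) f) (c≐d p q)

    switch-symmetric : ∀ v (f : C → C) {c} → Symmetric c → Symmetric (switch v f c)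
    switch-symmetric v f sym-c p q =
      cong₂ (λ b z → mapIf b f z) (∨-comm ⌊ p ≟ v ⌋ _) (sym-c p q)

    recolourEdge : Fin n → Fin n → (C → C) → Colouring n C → Colouring n C
    recolourEdge u v f c p q = mapIf (joins u v p q) f (c p q)

    recolourEdge-joined : ∀ {u v p q} f {c} → Symmetric c → u ≢ v → T (joins u v p q) →
                          recolourEdge u v f c p q ≡ map f (c u v)
    recolourEdge-joined {u} {v} {p} {q} f {c} sym-c u≢v t =
      trans (mapIf-true f (c p q) t) (cong (map f) (endpoint (joins⇒endpoints u≢v t)))
      where
      endpoint : (p ≡ u × q ≡ v) ⊎ (p ≡ v × q ≡ u) → c p q ≡ c u v
      endpoint (inj₁ (refl , refl)) = refl
      endpoint (inj₂ (refl , refl)) = sym-c v u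

MaybeΔ-refl : ∀ {m} (Γ : Permutation′ m → Set) z → MaybeΔ Γ z z
MaybeΔ-refl Γ nothing  = tt
MaybeΔ-refl Γ (just i) = id , ([] , [] , λ _ → refl) , refl

module _ {n m : ℕ} where

  Col : Set
  Col = Colouring n (Fin m)

  switchAll-cong : ∀ ss {c d : Col} → c ≐ d → switchAll ss c ≐ switchAll ss d
  switchAll-cong []             c≐d = c≐d
  switchAll-cong ((v , π) ∷ ss) c≐d = switch-cong v (π ⟨$⟩ʳ_) (switchAll-cong ss c≐d)

  switchAll-++ : ∀ ts ss (c : Col) → switchAll (ts ++ ss) c ≐ switchAll ts (switchAll ss c)
  switchAll-++ []             ss c p q = refl
  switchAll-++ ((v , π) ∷ ts) ss c     = switch-cong v (π ⟨$⟩ʳ_) (switchAll-++ ts ss c)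

  switchAll-symmetric : ∀ ss {c : Col} → Symmetric c → Symmetric (switchAll ss c)
  switchAll-symmetric []             sym-c = sym-c
  switchAll-symmetric ((v , π) ∷ ss) sym-c =
    switch-symmetric v (π ⟨$⟩ʳ_) (switchAll-symmetric ss sym-c)

  module _ (Γ : Permutation′ m → Set) where

    Reachable : Col → Col → Set
    Reachable c d = Σ (List (Fin n × Permutation′ m)) λ ss →
      All (λ vπ → Γ (proj₂ vπ)) ss × (switchAll ss c ≐ d)

    reachable-≐ : ∀ {c d} → c ≐ d → Reachable c d
    reachable-≐ c≐d = [] , [] , c≐d

    reachable-trans : ∀ {c d e} → Reachable c d → Reachable d e → Reachable c e
    reachable-trans {c} (ss , γss , c⇝d) (ts , γts , d⇝e) =
      ts ++ ss , ++⁺ γts γss ,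
      λ p q → trans (switchAll-++ ts ss c p q) (trans (switchAll-cong ts c⇝d p q) (d⇝e p q))

    reachable-resp-≐ : ∀ {c d e} → Reachable c d → d ≐ e → Reachable c e
    reachable-resp-≐ (ss , γss , c⇝d) d≐e = ss , γss , λ p q → trans (c⇝d p q) (d≐e p q)

    reachable-symmetric : ∀ {c d} → Symmetric c → Reachable c d → Symmetric d
    reachable-symmetric sym-c (ss , _ , c⇝d) p q =
      trans (sym (c⇝d p q)) (trans (switchAll-symmetric ss sym-c p q) (c⇝d q p))

    Between : Col → Col → Col → Set
    Between c d e = ∀ p q → e p q ≡ c p q ⊎ e p q ≡ d p q

    between-trans : ∀ {c d e₁ e₂} → Between c d e₁ → Between e₁ d e₂ → Between c d e₂
    between-trans c-e₁-d e₁-e₂-d p q with e₁-e₂-d p q | c-e₁-d p q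
    ... | inj₂ e₂≡d  | _          = inj₂ e₂≡d
    ... | inj₁ e₂≡e₁ | inj₁ e₁≡c  = inj₁ (trans e₂≡e₁ e₁≡c)
    ... | inj₁ e₂≡e₁ | inj₂ e₁≡d  = inj₂ (trans e₂≡e₁ e₁≡d)

    between-≈Δ : ∀ {c d e} → c ≈Δ[ Γ ] d → Between c d e → e ≈Δ[ Γ ] d
    between-≈Δ {d = d} c≈d c-e-d p q with c-e-d p q
    ... | inj₁ e≡c = subst (λ z → MaybeΔ Γ z (d p q)) (sym e≡c) (c≈d p q)
    ... | inj₂ e≡d = subst (λ z → MaybeΔ Γ z (d p q)) (sym e≡d) (MaybeΔ-refl Γ (d p q))

    module _ (isGroup : IsPermGroup Γ) where
      open IsPermGroup isGroup using (closed-⁻¹)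

      recolourEdge-commutator : ∀ u v {a b} → Γ a → Γ b → ∀ c →
                                Reachable c (recolourEdge u v (commutator a b ⟨$⟩ʳ_) c)
      recolourEdge-commutator u v {a} {b} γa γb c =
        (v , a) ∷ (u , b) ∷ (v , flip a) ∷ (u , flip b) ∷ [] ,
        γa ∷ γb ∷ closed-⁻¹ γa ∷ closed-⁻¹ γb ∷ [] ,
        λ p q → mapIf-commutator a b (incident u p q) (incident v p q) (c p q)

      recolourEdge-prodComm : ∀ u v cs → All (λ ab → Γ (proj₁ ab) × Γ (proj₂ ab)) cs → ∀ c →
                              Reachable c (recolourEdge u v (prodComm cs ⟨$⟩ʳ_) c)
      recolourEdge-prodComm u v [] [] c =
        reachable-≐ λ p q → sym (mapIf-id (joins u v p q) (c p q))
      recolourEdge-prodComm u v ((a , b) ∷ cs) ((γa , γb) ∷ γcs) c =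
        reachable-resp-≐
          (reachable-trans (recolourEdge-commutator u v γa γb c)
                           (recolourEdge-prodComm u v cs γcs _))
          λ p q → mapIf-∘ (joins u v p q) _ _ (c p q)

      recolourEdge-derived : ∀ u v {τ} → InCommutatorSubgroup Γ τ → ∀ c →
                             Reachable c (recolourEdge u v (τ ⟨$⟩ʳ_) c)
      recolourEdge-derived u v (cs , γcs , cs≈τ) c =
        reachable-resp-≐ (recolourEdge-prodComm u v cs γcs c)
          λ p q → mapIf-cong (joins u v p q) cs≈τ (c p q)

      fix-edge : ∀ {c d} → Symmetric c → Symmetric d → c ≈Δ[ Γ ] d → (∀ v → d v v ≡ nothing) →
                 ∀ x y → ∃ λ e → Reachable c e × Between c d e × e x y ≡ d x y
      fix-edge {c} {d} sym-c sym-d c≈d loopless x y = fix (c x y) (d x y) refl refl (c≈d x y)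
        where
        fix : ∀ cxy dxy → c x y ≡ cxy → d x y ≡ dxy → MaybeΔ Γ cxy dxy →
              ∃ λ e → Reachable c e × Between c d e × e x y ≡ d x y
        fix nothing nothing cxy dxy _ =
          c , reachable-≐ (λ _ _ → refl) , (λ _ _ → inj₁ refl) , trans cxy (sym dxy)
        fix (just i) (just j) cxy dxy (τ , τ∈[Γ,Γ] , τi≡j) =
          recolourEdge x y (τ ⟨$⟩ʳ_) c , recolourEdge-derived x y {τ} τ∈[Γ,Γ] c ,
          between , on-edge (joins-self x y)
          where
          x≢y : x ≢ y
          x≢y refl with trans (sym dxy) (loopless x)
          ... | ()

          on-edge : ∀ {p q} → T (joins x y p q) → recolourEdge x y (τ ⟨$⟩ʳ_) c p q ≡ d p q
          on-edge {p} {q} t = begin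
            recolourEdge x y (τ ⟨$⟩ʳ_) c p q ≡⟨ recolourEdge-joined (τ ⟨$⟩ʳ_) sym-c x≢y t ⟩
            map (τ ⟨$⟩ʳ_) (c x y)            ≡⟨ cong (map (τ ⟨$⟩ʳ_)) cxy ⟩
            just (τ ⟨$⟩ʳ i)                  ≡⟨ cong just τi≡j ⟩
            just j                           ≡⟨ dxy ⟨
            d x y                            ≡⟨ endpoint (joins⇒endpoints x≢y t) ⟩
            d p q                            ∎
            where
            open ≡-Reasoning
            endpoint : (p ≡ x × q ≡ y) ⊎ (p ≡ y × q ≡ x) → d x y ≡ d p q
            endpoint (inj₁ (refl , refl)) = refl
            endpoint (inj₂ (refl , refl)) = sym-d x y

          between : Between c d (recolourEdge x y (τ ⟨$⟩ʳ_) c)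
          between p q with T? (joins x y p q)
          ... | yes t  = inj₂ (on-edge t)
          ... | no  ¬t = inj₁ (mapIf-false (τ ⟨$⟩ʳ_) (c p q) ¬t)

      fix-edges : ∀ {c d} → Symmetric c → Symmetric d → c ≈Δ[ Γ ] d → (∀ v → d v v ≡ nothing) →
                  ∀ L → ∃ λ e → Reachable c e × Between c d e × (∀ {p q} → (p , q) ∈ L → e p q ≡ d p q)
      fix-edges {c} sym-c sym-d c≈d loopless [] =
        c , reachable-≐ (λ _ _ → refl) , (λ _ _ → inj₁ refl) , λ ()
      fix-edges {d = d} sym-c sym-d c≈d loopless ((x , y) ∷ L)
        with fix-edges sym-c sym-d c≈d loopless L
      ... | e₁ , c⇝e₁ , c-e₁-d , fixed-L
        with fix-edge (reachable-symmetric sym-c c⇝e₁) sym-d (between-≈Δ c≈d c-e₁-d) loopless x y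
      ... | e₂ , e₁⇝e₂ , e₁-e₂-d , fixed-xy =
        e₂ , reachable-trans c⇝e₁ e₁⇝e₂ , between-trans c-e₁-d e₁-e₂-d , fixed
        where
        fixed : ∀ {p q} → (p , q) ∈ (x , y) ∷ L → e₂ p q ≡ d p q
        fixed (here refl) = fixed-xy
        fixed {p} {q} (there pq∈L) with e₁-e₂-d p q
        ... | inj₁ e₂≡e₁ = trans e₂≡e₁ (fixed-L pq∈L)
        ... | inj₂ e₂≡d  = e₂≡d

      ≈Δ⇒reachable : ∀ {c d} → Symmetric c → Symmetric d → c ≈Δ[ Γ ] d →
                     (∀ v → d v v ≡ nothing) → Reachable c d
      ≈Δ⇒reachable sym-c sym-d c≈d loopless
        with fix-edges sym-c sym-d c≈d loopless (cartesianProduct (allFin n) (allFin n))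
      ... | e , c⇝e , _ , fixed =
        reachable-resp-≐ c⇝e λ p q → fixed (∈-cartesianProduct⁺ (∈-allFin p) (∈-allFin q))

theorem3p2 : (n m : ℕ) (Γ : Permutation′ m → Set) →
    IsPermGroup Γ → Transitive Γ →
    (G H : ColouredGraph n m) → SameUnderlying G H →
    (SwitchEquiv Γ G H → AbSwitchEquiv Γ (Abelianization Γ G) (Abelianization Γ H))
    × (AbSwitchEquiv Γ (Abelianization Γ G) (Abelianization Γ H) → SwitchEquiv Γ G H)
theorem3p2 n m Γ isGroup _ G H _ = forward , backward
  where
  forward : SwitchEquiv Γ G H → AbSwitchEquiv Γ (Abelianization Γ G) (Abelianization Γ H)
  forward (ss , γss , G⇝H) =
    ss , γss , λ p q → subst (MaybeΔ Γ _) (G⇝H p q) (MaybeΔ-refl Γ _)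

  backward : AbSwitchEquiv Γ (Abelianization Γ G) (Abelianization Γ H) → SwitchEquiv Γ G H
  backward (ss , γss , G'≈H) =
    reachable-trans Γ (ss , γss , λ _ _ → refl)
      (≈Δ⇒reachable Γ isGroup (switchAll-symmetric ss (symmetric G)) (symmetric H)
                    G'≈H (loopless H))
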